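{- Let $p$ and $i$ be nonnegative integers with $p\ge2$. Let $r,s$ be the unique integers with $r\in\{0,1,\dots,3p-1\}$ and $3p+i=3ps+r$. For $j\in\{0,1,2,3\}$ let $q_j(s)=(s+1)^js^{3-j}$. Let $S_{p,r}=\{(x_1,\dots,x_{2p})\in\{0,1,2,3\}^{2p}: x_1+\dots+x_{2p}=2r\}$ and, for $(x_1,\dots,x_{2p})\in S_{p,r}$, let $g_s(x_1,\dots,x_{2p})=\sum_{j=1}^{2p}q_{x_j}(s)$. Then $q_3(s)>q_2(s)>q_1(s)>q_0(s)$, and the minimum of $g_s$ over $S_{p,r}$ is attained precisely at those tuples in $S_{p,r}$ that are fair.
   Context: A tuple $(x_1,\dots,x_t)$ of integers is fair if $|x_a-x_b|\le1$ for all $a,b\in\{1,\dots,t\}$. -}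

module Defs where

open import Data.Nat using (ℕ; zero; suc; _+_; _*_; _^_; _≤_)
open import Data.Fin using (Fin; toℕ)
open import Data.Integer as ℤ using (ℤ; +_; ∣_∣)
open import Data.Product using (_×_)
open import Relation.Binary.PropositionalEquality using (_≡_)
import Data.Vec.Functional as VF

∑ : ∀ {n} → (Fin n → ℕ) → ℕ
∑ f = VF.foldr _+_ 0 f

Fair : ∀ {t} → (Fin t → ℤ) → Set
Fair {t} x = ∀ (a b : Fin t) → ∣ x a ℤ.- x b ∣ ≤ 1

q : Fin 4 → ℕ → ℕ
q j s = (s + 1) ^ toℕ j * s ^ (3 Data.Nat.∸ toℕ j)
  where import Data.Nat

asℤ : ∀ {t} → (Fin t → Fin 4) → (Fin t → ℤ)
asℤ x a = + toℕ (x a)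

InS : (p r : ℕ) → (Fin (2 * p) → Fin 4) → Set
InS p r x = ∑ (λ a → toℕ (x a)) ≡ 2 * r

g : ∀ {t} → ℕ → (Fin t → Fin 4) → ℕ
g s x = ∑ (λ a → q (x a) s)

-- For s ≥ 1 the increments s², s(s+1), (s+1)² of j ↦ q_j(s) strictly increase, so q(·, s) is
-- strictly convex on {0,1,2,3}. Hence if two coordinates of x differ by at least 2, moving
-- them one step towards each other keeps the coordinate sum and strictly lowers g_s, so
-- minimisers are fair. Conversely a fair tuple takes values in {m, m+1} for some m; the line
-- through (m, q_m) and (m+1, q_{m+1}) lies below q(·, s) and meets it exactly there, so
-- g_s(x) is the sum of that line over x, which only depends on the coordinate sum and is
-- at most g_s(y) for every y with the same coordinate sum.
module Submission where

open import Defs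
open import Data.Fin using (Fin; zero; suc; toℕ; inject₁; _≟_)
open import Data.Fin.Patterns using (0F; 1F; 2F; 3F)
open import Data.Fin.Properties using (any?; toℕ-inject₁)
open import Data.Integer as ℤ using (∣_∣)
open import Data.Nat using (ℕ; zero; suc; _+_; _*_; _^_; _∸_; _≤_; _<_; _≥_; z≤n; s≤s; z<s)
open import Data.Nat.Properties
  using (+-*-semiring; module ≤-Reasoning; +-assoc; +-comm; *-zeroʳ; ≤-refl; ≤-reflexive; <⇒≱;
         m≤m+n; m<m+n; +-mono-≤; +-monoʳ-<; +-cancelʳ-≡; +-cancelʳ-≤; +-cancelʳ-<)
open import Algebra.Properties.Semiring.Sum +-*-semiring using (sum-cong-≗; ∑-distrib-+; *-distribʳ-sum)
open import Data.Nat.Solver using (module +-*-Solver)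
open import Data.Product using (_×_; _,_; ∃; ∃₂)
open import Data.Sum using (_⊎_; inj₁; inj₂)
open import Data.Vec.Functional using (updateAt)
open import Data.Vec.Functional.Properties using (updateAt-minimal)
open import Function.Base using (_∘_; const; flip)
open import Function.Bundles using (_⇔_; mk⇔)
open import Relation.Binary.PropositionalEquality
  using (_≡_; _≢_; refl; sym; trans; cong; subst; module ≡-Reasoning)
open import Relation.Nullary using (¬_; yes; no; contradiction)

open +-*-Solver

∑-mono-≤ : ∀ {n} {f f′ : Fin n → ℕ} → (∀ a → f a ≤ f′ a) → ∑ f ≤ ∑ f′
∑-mono-≤ {zero}  f≤f′ = z≤n
∑-mono-≤ {suc n} f≤f′ = +-mono-≤ (f≤f′ zero) (∑-mono-≤ (f≤f′ ∘ suc))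

∑-updateAt : ∀ {A : Set} {n} (F : A → ℕ) (x : Fin n → A) a u →
  ∑ (F ∘ updateAt x a (const u)) + F (x a) ≡ ∑ (F ∘ x) + F u
∑-updateAt F x zero u =
  solve 3 (λ y r z → y :+ r :+ z := z :+ r :+ y) refl (F u) (∑ (F ∘ x ∘ suc)) (F (x zero))
∑-updateAt F x (suc a) u = begin
  F (x zero) + ∑ (F ∘ updateAt (x ∘ suc) a (const u)) + F (x (suc a))
    ≡⟨ +-assoc (F (x zero)) _ _ ⟩
  F (x zero) + (∑ (F ∘ updateAt (x ∘ suc) a (const u)) + F (x (suc a)))
    ≡⟨ cong (F (x zero) +_) (∑-updateAt F (x ∘ suc) a u) ⟩
  F (x zero) + (∑ (F ∘ x ∘ suc) + F u)
    ≡⟨ +-assoc (F (x zero)) _ _ ⟨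
  ∑ (F ∘ x) + F u ∎
  where open ≡-Reasoning

∑-updateAt₂ : ∀ {A : Set} {n} (F : A → ℕ) (x : Fin n → A) {a b} → a ≢ b → ∀ u v →
  ∑ (F ∘ updateAt (updateAt x a (const u)) b (const v)) + (F (x a) + F (x b))
    ≡ ∑ (F ∘ x) + (F u + F v)
∑-updateAt₂ {A} {n} F x {a} {b} a≢b u v = begin
  ∑ (F ∘ y) + (F (x a) + F (x b))
    ≡⟨ solve 3 (λ t p r → t :+ (p :+ r) := t :+ r :+ p) refl (∑ (F ∘ y)) (F (x a)) (F (x b)) ⟩
  ∑ (F ∘ y) + F (x b) + F (x a)
    ≡⟨ cong (λ j → ∑ (F ∘ y) + F j + F (x a)) (updateAt-minimal b a x (a≢b ∘ sym)) ⟨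
  ∑ (F ∘ y) + F (x′ b) + F (x a)
    ≡⟨ cong (_+ F (x a)) (∑-updateAt F x′ b v) ⟩
  ∑ (F ∘ x′) + F v + F (x a)
    ≡⟨ solve 3 (λ t p r → t :+ p :+ r := t :+ r :+ p) refl (∑ (F ∘ x′)) (F v) (F (x a)) ⟩
  ∑ (F ∘ x′) + F (x a) + F v
    ≡⟨ cong (_+ F v) (∑-updateAt F x a u) ⟩
  ∑ (F ∘ x) + F u + F v
    ≡⟨ +-assoc (∑ (F ∘ x)) _ _ ⟩
  ∑ (F ∘ x) + (F u + F v) ∎
  where
  open ≡-Reasoning
  x′ y : Fin n → A
  x′ = updateAt x a (const u)
  y  = updateAt x′ b (const v)

module SeparableMinimisation {A : Set} (w h : A → ℕ) where

  Minimiser : ∀ {n} → (Fin n → A) → Set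
  Minimiser {n} x = ∀ (y : Fin n → A) → ∑ (w ∘ y) ≡ ∑ (w ∘ x) → ∑ (h ∘ x) ≤ ∑ (h ∘ y)

  Improvable : A → A → Set
  Improvable i j = ∃₂ λ u v → w u + w v ≡ w i + w j × h u + h v < h i + h j

  improvable-sym : ∀ {i j} → Improvable i j → Improvable j i
  improvable-sym {i} {j} (u , v , same-weight , cheaper) =
    u , v , trans same-weight (+-comm (w i) (w j)) ,
    subst (h u + h v <_) (+-comm (h i) (h j)) cheaper

  improvable⇒¬minimiser : ∀ {n} (x : Fin n → A) {a b} → a ≢ b →
    Improvable (x a) (x b) → ¬ Minimiser x
  improvable⇒¬minimiser {n} x {a} {b} a≢b (u , v , same-weight , cheaper) minimiser =
    <⇒≱ cost-drops (minimiser y weight-kept)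
    where
    y : Fin n → A
    y = updateAt (updateAt x a (const u)) b (const v)

    weight-kept : ∑ (w ∘ y) ≡ ∑ (w ∘ x)
    weight-kept = +-cancelʳ-≡ (w (x a) + w (x b)) _ _
      (trans (∑-updateAt₂ w x a≢b u v) (cong (∑ (w ∘ x) +_) same-weight))

    cost-drops : ∑ (h ∘ y) < ∑ (h ∘ x)
    cost-drops = +-cancelʳ-< (h (x a) + h (x b)) _ _
      (subst (_< ∑ (h ∘ x) + (h (x a) + h (x b))) (sym (∑-updateAt₂ h x a≢b u v))
             (+-monoʳ-< (∑ (h ∘ x)) cheaper))

  -- The supporting line is j ↦ c + w j * D − M; M is moved to the other side so that lines
  -- with a negative intercept stay within ℕ.
  supporting-line⇒minimiser : ∀ {n} (x : Fin n → A) (c D M : ℕ) →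
    (∀ j → c + w j * D ≤ h j + M) → (∀ a → c + w (x a) * D ≡ h (x a) + M) → Minimiser x
  supporting-line⇒minimiser {n} x c D M below touches y same-weight = +-cancelʳ-≤ (∑ M⃗) _ _ (begin
    ∑ (h ∘ x) + ∑ M⃗                ≡⟨ ∑-distrib-+ (h ∘ x) M⃗ ⟨
    ∑ (λ a → h (x a) + M)          ≡⟨ sum-cong-≗ touches ⟨
    ∑ (λ a → c + w (x a) * D)      ≡⟨ line-sum x ⟩
    ∑ c⃗ + ∑ (w ∘ x) * D            ≡⟨ cong (λ t → ∑ c⃗ + t * D) same-weight ⟨
    ∑ c⃗ + ∑ (w ∘ y) * D            ≡⟨ line-sum y ⟨
    ∑ (λ a → c + w (y a) * D)      ≤⟨ ∑-mono-≤ (below ∘ y) ⟩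
    ∑ (λ a → h (y a) + M)          ≡⟨ ∑-distrib-+ (h ∘ y) M⃗ ⟩
    ∑ (h ∘ y) + ∑ M⃗                ∎)
    where
    open ≤-Reasoning
    M⃗ c⃗ : Fin n → ℕ
    M⃗ = const M
    c⃗ = const c

    line-sum : ∀ z → ∑ (λ a → c + w (z a) * D) ≡ ∑ c⃗ + ∑ (w ∘ z) * D
    line-sum z = trans (∑-distrib-+ c⃗ (λ a → w (z a) * D))
                       (cong (∑ c⃗ +_) (sym (*-distribʳ-sum D (w ∘ z))))

≤-by-gap : ∀ {m n} e → m + e ≡ n → m ≤ n
≤-by-gap e refl = m≤m+n _ e

<-by-gap : ∀ {m n} e → 0 < e → m + e ≡ n → m < n
<-by-gap e e>0 refl = m<m+n _ e>0

Δq : Fin 3 → ℕ → ℕ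
Δq m s = (s + 1) ^ toℕ m * s ^ (2 ∸ toℕ m)

qᴾ : ∀ {n} → Fin 4 → Polynomial n → Polynomial n
qᴾ j s = (s :+ con 1) :^ toℕ j :* s :^ (3 ∸ toℕ j)

Δqᴾ : ∀ {n} → Fin 3 → Polynomial n → Polynomial n
Δqᴾ m s = (s :+ con 1) :^ toℕ m :* s :^ (2 ∸ toℕ m)

lineᴾ curveᴾ : ∀ {n} → Fin 3 → Fin 4 → Polynomial n → Polynomial n
lineᴾ m j s = qᴾ (inject₁ m) s :+ con (toℕ j) :* Δqᴾ m s
curveᴾ m j s = qᴾ j s :+ con (toℕ m) :* Δqᴾ m s

q-suc : ∀ m s → q (inject₁ m) s + Δq m s ≡ q (suc m) s
q-suc 0F = solve 1 (λ s → qᴾ 0F s :+ Δqᴾ 0F s := qᴾ 1F s) refl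
q-suc 1F = solve 1 (λ s → qᴾ 1F s :+ Δqᴾ 1F s := qᴾ 2F s) refl
q-suc 2F = solve 1 (λ s → qᴾ 2F s :+ Δqᴾ 2F s := qᴾ 3F s) refl

Δq-positive : ∀ {s} → 0 < s → ∀ m → 0 < Δq m s
Δq-positive {suc _} _ 0F = z<s
Δq-positive {suc _} _ 1F = z<s
Δq-positive {suc _} _ 2F = z<s

q-increasing : ∀ {s} → 0 < s → ∀ m → q (inject₁ m) s < q (suc m) s
q-increasing {s} s>0 m = subst (q (inject₁ m) s <_) (q-suc m s) (m<m+n _ (Δq-positive s>0 m))

on-tangent : ∀ s m {j} → j ≡ inject₁ m ⊎ j ≡ suc m →
  q (inject₁ m) s + toℕ j * Δq m s ≡ q j s + toℕ m * Δq m s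
on-tangent s m (inj₁ refl) = cong (λ t → q (inject₁ m) s + t * Δq m s) (toℕ-inject₁ m)
on-tangent s m (inj₂ refl) = begin
  q (inject₁ m) s + (Δq m s + toℕ m * Δq m s)  ≡⟨ +-assoc (q (inject₁ m) s) _ _ ⟨
  q (inject₁ m) s + Δq m s + toℕ m * Δq m s    ≡⟨ cong (_+ toℕ m * Δq m s) (q-suc m s) ⟩
  q (suc m) s + toℕ m * Δq m s                 ∎
  where open ≡-Reasoning

below-tangent : ∀ s m j → q (inject₁ m) s + toℕ j * Δq m s ≤ q j s + toℕ m * Δq m s
below-tangent s 0F 0F = ≤-refl
below-tangent s 0F 1F = ≤-reflexive (on-tangent s 0F (inj₂ refl))
below-tangent s 0F 2F = ≤-by-gap s (solve 1 (λ s → lineᴾ 0F 2F s :+ s := curveᴾ 0F 2F s) refl s)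
below-tangent s 0F 3F =
  ≤-by-gap (3 * s + 1)
    (solve 1 (λ s → lineᴾ 0F 3F s :+ (con 3 :* s :+ con 1) := curveᴾ 0F 3F s) refl s)
below-tangent s 1F 0F = ≤-by-gap s (solve 1 (λ s → lineᴾ 1F 0F s :+ s := curveᴾ 1F 0F s) refl s)
below-tangent s 1F 1F = ≤-refl
below-tangent s 1F 2F = ≤-reflexive (on-tangent s 1F (inj₂ refl))
below-tangent s 1F 3F =
  ≤-by-gap (s + 1) (solve 1 (λ s → lineᴾ 1F 3F s :+ (s :+ con 1) := curveᴾ 1F 3F s) refl s)
below-tangent s 2F 0F =
  ≤-by-gap (3 * s + 2)
    (solve 1 (λ s → lineᴾ 2F 0F s :+ (con 3 :* s :+ con 2) := curveᴾ 2F 0F s) refl s)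
below-tangent s 2F 1F =
  ≤-by-gap (s + 1) (solve 1 (λ s → lineᴾ 2F 1F s :+ (s :+ con 1) := curveᴾ 2F 1F s) refl s)
below-tangent s 2F 2F = ≤-refl
below-tangent s 2F 3F = ≤-reflexive (on-tangent s 2F (inj₂ refl))

Near : Fin 4 → Fin 4 → Set
Near i j = ∣ ℤ.+ toℕ i ℤ.- ℤ.+ toℕ j ∣ ≤ 1

near-0⇒0∨1 : ∀ {i} → Near i 0F → i ≡ 0F ⊎ i ≡ 1F
near-0⇒0∨1 {0F} _ = inj₁ refl
near-0⇒0∨1 {1F} _ = inj₂ refl
near-0⇒0∨1 {2F} (s≤s ())
near-0⇒0∨1 {3F} (s≤s ())

near-1⇒1∨2 : ∀ {i} → i ≢ 0F → Near i 1F → i ≡ 1F ⊎ i ≡ 2F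
near-1⇒1∨2 {0F} i≢0 _ = contradiction refl i≢0
near-1⇒1∨2 {1F} _ _ = inj₁ refl
near-1⇒1∨2 {2F} _ _ = inj₂ refl
near-1⇒1∨2 {3F} _ (s≤s ())

≢0∧≢1⇒2∨3 : ∀ {i : Fin 4} → i ≢ 0F → i ≢ 1F → i ≡ 2F ⊎ i ≡ 3F
≢0∧≢1⇒2∨3 {0F} i≢0 _ = contradiction refl i≢0
≢0∧≢1⇒2∨3 {1F} _ i≢1 = contradiction refl i≢1
≢0∧≢1⇒2∨3 {2F} _ _ = inj₁ refl
≢0∧≢1⇒2∨3 {3F} _ _ = inj₂ refl

fair⇒two-valued : ∀ {n} (x : Fin n → Fin 4) → Fair (asℤ x) →
  ∃ λ m → ∀ a → x a ≡ inject₁ m ⊎ x a ≡ suc m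
fair⇒two-valued x fair with any? (λ a → x a ≟ 0F)
... | yes (a₀ , xa₀≡0) = 0F , λ a → near-0⇒0∨1 (subst (Near (x a)) xa₀≡0 (fair a a₀))
... | no ∄0 with any? (λ a → x a ≟ 1F)
...   | yes (a₁ , xa₁≡1) =
  1F , λ a → near-1⇒1∨2 (∄0 ∘ (a ,_)) (subst (Near (x a)) xa₁≡1 (fair a a₁))
...   | no ∄1 = 2F , λ a → ≢0∧≢1⇒2∨3 (∄0 ∘ (a ,_)) (∄1 ∘ (a ,_))

module _ (s : ℕ) where
  open SeparableMinimisation toℕ (flip q s)

  fair⇒minimiser : ∀ {n} (x : Fin n → Fin 4) → Fair (asℤ x) → Minimiser x
  fair⇒minimiser x fair with fair⇒two-valued x fair
  ... | m , two-valued = supporting-line⇒minimiser x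
    (q (inject₁ m) s) (Δq m s) (toℕ m * Δq m s) (below-tangent s m) (on-tangent s m ∘ two-valued)

  improvable-3-0 : Improvable 3F 0F
  improvable-3-0 = 2F , 1F , refl ,
    <-by-gap (1 + 2 * s) z<s
      (solve 1 (λ s → qᴾ 2F s :+ qᴾ 1F s :+ (con 1 :+ con 2 :* s) := qᴾ 3F s :+ qᴾ 0F s) refl s)

  improvable-3-1 : Improvable 3F 1F
  improvable-3-1 = 2F , 2F , refl ,
    <-by-gap (1 + s) z<s
      (solve 1 (λ s → qᴾ 2F s :+ qᴾ 2F s :+ (con 1 :+ s) := qᴾ 3F s :+ qᴾ 1F s) refl s)

  module _ (s>0 : 0 < s) where

    improvable-2-0 : Improvable 2F 0F
    improvable-2-0 = 1F , 1F , refl ,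
      <-by-gap s s>0 (solve 1 (λ s → qᴾ 1F s :+ qᴾ 1F s :+ s := qᴾ 2F s :+ qᴾ 0F s) refl s)

    near-or-improvable : ∀ i j → Near i j ⊎ (i ≢ j × Improvable i j)
    near-or-improvable 0F 0F = inj₁ z≤n
    near-or-improvable 0F 1F = inj₁ ≤-refl
    near-or-improvable 0F 2F = inj₂ ((λ ()) , improvable-sym {2F} {0F} improvable-2-0)
    near-or-improvable 0F 3F = inj₂ ((λ ()) , improvable-sym {3F} {0F} improvable-3-0)
    near-or-improvable 1F 0F = inj₁ ≤-refl
    near-or-improvable 1F 1F = inj₁ z≤n
    near-or-improvable 1F 2F = inj₁ ≤-refl
    near-or-improvable 1F 3F = inj₂ ((λ ()) , improvable-sym {3F} {1F} improvable-3-1)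
    near-or-improvable 2F 0F = inj₂ ((λ ()) , improvable-2-0)
    near-or-improvable 2F 1F = inj₁ ≤-refl
    near-or-improvable 2F 2F = inj₁ z≤n
    near-or-improvable 2F 3F = inj₁ ≤-refl
    near-or-improvable 3F 0F = inj₂ ((λ ()) , improvable-3-0)
    near-or-improvable 3F 1F = inj₂ ((λ ()) , improvable-3-1)
    near-or-improvable 3F 2F = inj₁ ≤-refl
    near-or-improvable 3F 3F = inj₁ z≤n

    minimiser⇒fair : ∀ {n} (x : Fin n → Fin 4) → Minimiser x → Fair (asℤ x)
    minimiser⇒fair x minimiser a b with near-or-improvable (x a) (x b)
    ... | inj₁ near = near
    ... | inj₂ (xa≢xb , improvable) =
      contradiction minimiser (improvable⇒¬minimiser x (xa≢xb ∘ cong x) improvable)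

quotient-positive : ∀ {d i r} s → r < d → d + i ≡ d * s + r → 0 < s
quotient-positive {d} {i} {r} zero r<d division =
  contradiction (subst (d ≤_) (trans division (cong (_+ r) (*-zeroʳ d))) (m≤m+n d i)) (<⇒≱ r<d)
quotient-positive (suc _) _ _ = z<s

lemma6 : (p i r s : ℕ) → p ≥ 2 → r < 3 * p → 3 * p + i ≡ 3 * p * s + r →
    (q (suc (suc zero)) s < q (suc (suc (suc zero))) s
      × q (suc zero) s < q (suc (suc zero)) s
      × q zero s < q (suc zero) s)
    × (∀ (x : Fin (2 * p) → Fin 4) → InS p r x →
         ((∀ (y : Fin (2 * p) → Fin 4) → InS p r y → g s x ≤ g s y)
           ⇔ Fair (asℤ x)))
lemma6 p i r s _ r<3p division =
  (q-increasing s>0 2F , q-increasing s>0 1F , q-increasing s>0 0F) ,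
  λ x x∈S → mk⇔
    (λ minimal → minimiser⇒fair s s>0 x (λ y same-sum → minimal y (trans same-sum x∈S)))
    (λ fair y y∈S → fair⇒minimiser s x fair y (trans y∈S (sym x∈S)))
  where
  s>0 : 0 < s
  s>0 = quotient-positive s r<3p division
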